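{- Let $b,c_1,c_2$ be positive integers and $n=b+c_1+c_2$. Let $R$ be the map which sends a tableau $T$ of shape the right lobster $\mathcal{L}^{c_1,c_2}_b$ to the tableau obtained by replacing each entry $i$ by $n+1-i$ and rotating the result by 180 degrees. Then $R$ is a poset isomorphism from $\mathrm{SET}(\mathcal{L}^{c_1,c_2}_b)$ to $\mathrm{SET}$ of the left lobster associated to the triple $(b,c_2,c_1)$.
   Context: Compositions, diagrams (rows numbered from bottom, columns from left), and skew diagrams $\alpha/\beta$ for compositions $\beta\subseteq\alpha$ are as usual: $\alpha/\beta$ is the set of cells of the diagram of $\alpha$ (with $\alpha_i$ left-justified cells in row $i$) not in that of $\beta$. For positive integers $b,c_1,c_2$, the right lobster $\mathcal{L}^{c_1,c_2}_b$ is $\alpha/\beta$ with $\alpha=(b+1+c_2,b+1,b+1+c_1)$, $\beta=(b+1,1,b+1)$: a top row (claw) of $c_1$ cells and a bottom row (claw) of $c_2$ cells, both starting at column $b+2$, and a middle row (body) of $b$ cells in columns $2,\ldots,b+1$. The left lobster associated to the triple $(b,c_1,c_2)$ is the three-row skew shape whose top row has $c_1$ cells and bottom row has $c_2$ cells, both right-justified ending at the same column $m=\max(c_1,c_2)$, and whose middle row (body) has $b$ cells in columns $m+1,\ldots,m+b$ (i.e. $\alpha=(m,m+b,m)$, $\beta=(m-c_2,m,m-c_1)$). For a skew shape with $n$ cells, a standard extended tableau is a bijective filling with $1,\ldots,n$ strictly increasing left to right along rows and bottom to top along columns; $\mathrm{SET}$ denotes the set of these. For $1\le i\le n-1$, $\pi_i(T)=T$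 if $i+1$ is in a strictly higher row than $i$, $\pi_i(T)=s_i(T)$ (swap $i$ and $i+1$) if $i+1$ is in a strictly lower row than $i$, and $\pi_i(T)=0$ if they are in the same row. Poset on $\mathrm{SET}$: $S\le T$ iff $T$ is obtained from $S$ by a finite sequence of operators $\pi_i$ with all intermediate results nonzero. -}

module Defs where

open import Data.Nat using (ℕ; zero; suc; _+_; _∸_; _<_; _≤_; _⊔_; _≡ᵇ_; _<ᵇ_)
open import Data.Bool using (Bool; true; false; if_then_else_; _∨_)
open import Data.List using (List; []; _∷_; map; reverse; concat; length; upTo; zipWith)
open import Data.List.Relation.Unary.All using (All)
open import Data.List.Relation.Unary.Linked using (Linked)
open import Data.List.Relation.Binary.Pointwise using (Pointwise)
open import Data.List.Relation.Binary.Permutation.Propositional using (_↭_)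
open import Data.Maybe using (Maybe; just; nothing)
open import Data.Nat.ListAction using (sum)
open import Data.Product using (Σ; _×_; _,_; proj₁)
open import Relation.Binary.PropositionalEquality using (_≡_)
open import Relation.Binary.Construct.Closure.ReflexiveTransitive using (Star)

-- A skew shape α/β is given row by row, rows listed from the bottom (row 1)
-- upward; each row i is the pair (α_i , β_i): its cells are the columns
-- β_i + 1 , … , α_i (columns numbered from 1 at the left).
Shape : Set
Shape = List (ℕ × ℕ)

skew : List ℕ → List ℕ → Shape
skew α β = zipWith _,_ α β

rowLen : ℕ × ℕ → ℕ
rowLen (a , b) = a ∸ b

size : Shape → ℕ
size sh = sum (map rowLen sh)

rightLobster : ℕ → ℕ → ℕ → Shape
rightLobster b c₁ c₂ =
  skew (b + 1 + c₂ ∷ b + 1 ∷ b + 1 + c₁ ∷ []) (b + 1 ∷ 1 ∷ b + 1 ∷ [])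

leftLobster : ℕ → ℕ → ℕ → Shape
leftLobster b c₁ c₂ =
  skew (m ∷ m + b ∷ m ∷ []) (m ∸ c₂ ∷ m ∷ m ∸ c₁ ∷ [])
  where m = c₁ ⊔ c₂

-- A filling of a shape: a list of rows (bottom row first), each row the
-- list of its entries from left to right.
Filling : Set
Filling = List (List ℕ)

nth : {A : Set} → List A → ℕ → Maybe A
nth []       _       = nothing
nth (x ∷ xs) zero    = just x
nth (x ∷ xs) (suc k) = nth xs k

-- entry of the filling T (of shape sh) in row r (0-based from the bottom)
-- and column c (1-based from the left), if that cell belongs to the shape.
entry : Shape → Filling → ℕ → ℕ → Maybe ℕ
entry sh T r c with nth sh r | nth T r
... | just (a , b) | just row = if b <ᵇ c then nth row (c ∸ suc b) else nothing
... | _            | _        = nothing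

record IsSET (sh : Shape) (T : Filling) : Set where
  field
    shapeOK   : Pointwise (λ row ab → length row ≡ rowLen ab) T sh
    rowsInc   : All (Linked _<_) T
    colsInc   : ∀ r r' c x y → r < r' → entry sh T r c ≡ just x →
                entry sh T r' c ≡ just y → x < y
    bijective : concat T ↭ map suc (upTo (size sh))

SET : Shape → Set
SET sh = Σ Filling (IsSET sh)

elem : ℕ → List ℕ → Bool
elem x []       = false
elem x (y ∷ ys) = (x ≡ᵇ y) ∨ elem x ys

-- row (0-based from the bottom) containing x
rowOf : Filling → ℕ → Maybe ℕ
rowOf []         x = nothing
rowOf (row ∷ T) x with elem x row
... | true  = just zero
... | false with rowOf T x
...   | just r  = just (suc r)
...   | nothing = nothing

swapEnt : ℕ → Filling → Filling
swapEnt i = map (map (λ x → if x ≡ᵇ i then suc i else if x ≡ᵇ suc i then i else x))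

-- π_i ; the value 0 is represented by nothing
π : ℕ → Filling → Maybe Filling
π i T with rowOf T i | rowOf T (suc i)
... | just r | just r' =
  if r <ᵇ r' then just T else if r' <ᵇ r then just (swapEnt i T) else nothing
... | _ | _ = nothing

Step : Shape → Filling → Filling → Set
Step sh S T = Σ ℕ λ i → (1 ≤ i) × (suc i ≤ size sh) × (π i S ≡ just T)

_≼[_]_ : Filling → Shape → Filling → Set
S ≼[ sh ] T = Star (Step sh) S T

-- R : replace each entry i by n+1-i and rotate by 180 degrees
-- (reverse the order of the rows and reverse each row).
Rmap : ℕ → Filling → Filling
Rmap n T = reverse (map (λ row → reverse (map (λ x → suc n ∸ x) row)) T)

-- R is the 180-degree rotation composed with the complement x ↦ n + 1 − x. For every skew shape
-- drawn in N columns it maps standard extended tableaux to standard extended tableaux of the rotated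
-- shape: rows and columns are reversed while the entries are reversed in order. The right lobster
-- L_b^{c₁,c₂}, rotated inside b + 1 + max(c₁, c₂) columns, is the left lobster of (b, c₂, c₁) and vice
-- versa, and R is an involution, so R is a bijection between the two sets of tableaux. For the order:
-- complementing turns the pair i, i + 1 into n + 1 − i, n − i and reversing the rows reverses which one
-- lies higher, so R ∘ π_i = π_{n−i} ∘ R on fillings with distinct entries. Hence R sends chains of
-- nonzero π-steps to such chains, and so does its inverse R.

module Submission where

open import Data.Bool using (true; false; if_then_else_)
open import Data.Bool.Properties using (T-≡; ⇔→≡; ∨-zeroʳ)
open import Data.Empty using (⊥; ⊥-elim)
open import Data.List
  using (List; []; _∷_; _++_; _∷ʳ_; map; reverse; reverseAcc; concat; length; upTo; downFrom; applyUpTo)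
open import Data.List.Properties
  using ( map-∘; map-cong-local; map-id-local; map-upTo; reverse-map; reverse-upTo; reverse-++
        ; reverse-involutive; unfold-reverse; length-reverse; length-map; concat-map; concat-++; ++-identityʳ)
open import Data.List.Membership.Propositional using (_∈_)
open import Data.List.Membership.Propositional.Properties using (∈-map⁺; ∈-map⁻; ∈-++⁺ʳ)
open import Data.List.Relation.Binary.Permutation.Propositional
  using (_↭_; ↭-sym; ↭⇒↭ₛ; module PermutationReasoning)
open import Data.List.Relation.Binary.Permutation.Propositional.Properties using (All-resp-↭; ↭-reverse)
import Data.List.Relation.Binary.Permutation.Propositional.Properties as Perm
open import Data.List.Relation.Binary.Pointwise as Pointwise using (Pointwise; []; _∷_)
open import Data.List.Relation.Unary.All as All using (All; []; _∷_)
import Data.List.Relation.Unary.All.Properties as All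
open import Data.List.Relation.Unary.Any using (here; there)
import Data.List.Relation.Unary.Any.Properties as Any
open import Data.List.Relation.Unary.Linked using (Linked; []; [-]; _∷_)
import Data.List.Relation.Unary.Linked.Properties as Linked
open import Data.List.Relation.Unary.Unique.Propositional using (Unique; _∷_)
import Data.List.Relation.Unary.Unique.Propositional.Properties as Unique
open import Data.Maybe using (Maybe; just; nothing; _<∣>_) renaming (map to mapMaybe)
open import Data.Maybe.Properties using (just-injective)
open import Data.Maybe.Relation.Unary.All as Maybe using (just; nothing)
open import Data.Nat
open import Data.Nat.ListAction using (sum)
open import Data.Nat.ListAction.Properties using (sum-↭)
open import Data.Nat.Properties
open import Data.Product using (Σ; ∃; _×_; _,_; proj₁; proj₂; uncurry)
open import Data.Sum using (_⊎_; inj₁; inj₂)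
open import Function using (_∘_; flip)
open import Function.Bundles using (_⇔_; mk⇔; Equivalence)
open import Relation.Binary.Construct.Closure.ReflexiveTransitive using (ε; _◅_)
open import Relation.Binary.PropositionalEquality
open import Relation.Binary.PropositionalEquality.Properties using (setoid)
open import Relation.Nullary using (yes; no)
open import Relation.Nullary.Decidable using (dec-true; dec-false)

open import Data.List.Relation.Binary.Permutation.Setoid.Properties (setoid ℕ) using (Unique-resp-↭)

open import Defs

-- Complement and adjacent transpositions of values

complement : ℕ → ℕ → ℕ
complement n x = suc n ∸ x

complement-involutive : ∀ {n x} → x ≤ suc n → complement n (complement n x) ≡ x
complement-involutive = m∸[m∸n]≡n

complement-≤ : ∀ n x → complement n x ≤ suc n
complement-≤ n x = m∸n≤m (suc n) x

complement-injective : ∀ {n x y} → x ≤ suc n → y ≤ suc n →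
                       complement n x ≡ complement n y → x ≡ y
complement-injective {n} {x} {y} x≤ y≤ eq = begin
  x                             ≡⟨ complement-involutive x≤ ⟨
  complement n (complement n x) ≡⟨ cong (complement n) eq ⟩
  complement n (complement n y) ≡⟨ complement-involutive y≤ ⟩
  y                             ∎
  where open ≡-Reasoning

complement-antitone : ∀ {n x y} → x < y → y ≤ suc n → complement n y < complement n x
complement-antitone = ∸-monoʳ-<

transpose : ℕ → ℕ → ℕ
transpose i x = if x ≡ᵇ i then suc i else if x ≡ᵇ suc i then i else x

transpose-left : ∀ i → transpose i i ≡ suc i
transpose-left i rewrite dec-true (i ≟ i) refl = refl

transpose-right : ∀ i → transpose i (suc i) ≡ i
transpose-right i rewrite dec-false (suc i ≟ i) 1+n≢n | dec-true (suc i ≟ suc i) refl = refl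

transpose-other : ∀ {i x} → x ≢ i → x ≢ suc i → transpose i x ≡ x
transpose-other {i} {x} x≢i x≢1+i rewrite dec-false (x ≟ i) x≢i | dec-false (x ≟ suc i) x≢1+i = refl

transpose-involutive : ∀ i x → transpose i (transpose i x) ≡ x
transpose-involutive i x with x ≟ i | x ≟ suc i
... | yes refl | _        = trans (cong (transpose i) (transpose-left i)) (transpose-right i)
... | no _     | yes refl = trans (cong (transpose i) (transpose-right i)) (transpose-left i)
... | no p     | no q     = trans (cong (transpose i) (transpose-other p q)) (transpose-other p q)

transpose-injective : ∀ i {x y} → transpose i x ≡ transpose i y → x ≡ y
transpose-injective i {x} {y} eq =
  trans (sym (transpose-involutive i x)) (trans (cong (transpose i) eq) (transpose-involutive i y))

transpose-≤ : ∀ {m i x} → suc i ≤ m → x ≤ m → transpose i x ≤ m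
transpose-≤ {m} {i} {x} 1+i≤m x≤m with x ≟ i | x ≟ suc i
... | yes refl | _        = subst (_≤ m) (sym (transpose-left i)) 1+i≤m
... | no _     | yes refl = subst (_≤ m) (sym (transpose-right i)) (≤-trans (n≤1+n i) 1+i≤m)
... | no p     | no q     = subst (_≤ m) (sym (transpose-other p q)) x≤m

transpose-conjugate : ∀ {P : ℕ → Set} (f : ℕ → ℕ) {i j} →
  (∀ {x y} → P x → P y → f x ≡ f y → x ≡ y) → P i → P (suc i) →
  f i ≡ suc j → f (suc i) ≡ j → ∀ {x} → P x → transpose j (f x) ≡ f (transpose i x)
transpose-conjugate f {i} {j} inj Pi P1+i fi f1+i {x} Px with x ≟ i | x ≟ suc i
... | yes refl | _ = begin
  transpose j (f x)       ≡⟨ cong (transpose j) fi ⟩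
  transpose j (suc j)     ≡⟨ transpose-right j ⟩
  j                       ≡⟨ f1+i ⟨
  f (suc x)               ≡⟨ cong f (transpose-left x) ⟨
  f (transpose x x)       ∎
  where open ≡-Reasoning
... | no _ | yes refl = begin
  transpose j (f (suc i)) ≡⟨ cong (transpose j) f1+i ⟩
  transpose j j           ≡⟨ transpose-left j ⟩
  suc j                   ≡⟨ fi ⟨
  f i                     ≡⟨ cong f (transpose-right i) ⟨
  f (transpose i (suc i)) ∎
  where open ≡-Reasoning
... | no p | no q =
  trans (transpose-other (λ e → q (inj Px P1+i (trans e (sym f1+i))))
                         (λ e → p (inj Px Pi (trans e (sym fi)))))
        (cong f (sym (transpose-other p q)))

nth-map : ∀ {A B : Set} (f : A → B) xs i → nth (map f xs) i ≡ mapMaybe f (nth xs i)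
nth-map f []       i       = refl
nth-map f (x ∷ xs) zero    = refl
nth-map f (x ∷ xs) (suc i) = nth-map f xs i

nth-< : ∀ {A : Set} (xs : List A) i {x} → nth xs i ≡ just x → i < length xs
nth-< (y ∷ xs) zero    _ = z<s
nth-< (y ∷ xs) (suc i) e = s<s (nth-< xs i e)

nth-All : ∀ {A : Set} {P : A → Set} {xs i x} → All P xs → nth xs i ≡ just x → P x
nth-All {i = zero}  (p ∷ _)  refl = p
nth-All {i = suc i} (_ ∷ ps) e    = nth-All ps e

nth-Pointwise : ∀ {A B : Set} {R : A → B → Set} {xs ys i x y} →
                Pointwise R xs ys → nth xs i ≡ just x → nth ys i ≡ just y → R x y
nth-Pointwise {i = zero}  (r ∷ _)  refl refl = r
nth-Pointwise {i = suc i} (_ ∷ rs) e    e′   = nth-Pointwise rs e e′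

nth-∷ʳ-< : ∀ {A : Set} (xs : List A) y {i} → i < length xs → nth (xs ∷ʳ y) i ≡ nth xs i
nth-∷ʳ-< (x ∷ xs) y {zero}  _       = refl
nth-∷ʳ-< (x ∷ xs) y {suc i} (s<s p) = nth-∷ʳ-< xs y p

nth-∷ʳ-length : ∀ {A : Set} (xs : List A) y → nth (xs ∷ʳ y) (length xs) ≡ just y
nth-∷ʳ-length []       y = refl
nth-∷ʳ-length (x ∷ xs) y = nth-∷ʳ-length xs y

nth-reverse : ∀ {A : Set} (xs : List A) i → i < length xs →
              nth (reverse xs) i ≡ nth xs (length xs ∸ suc i)
nth-reverse (x ∷ xs) i (s≤s i≤L) with m≤n⇒m<n∨m≡n i≤L
... | inj₁ i<L = begin
  nth (reverse (x ∷ xs)) i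
    ≡⟨ cong (flip nth i) (unfold-reverse x xs) ⟩
  nth (reverse xs ∷ʳ x) i
    ≡⟨ nth-∷ʳ-< (reverse xs) x (subst (i <_) (sym (length-reverse xs)) i<L) ⟩
  nth (reverse xs) i
    ≡⟨ nth-reverse xs i i<L ⟩
  nth (x ∷ xs) (suc (length xs ∸ suc i)) ≡⟨ cong (nth (x ∷ xs)) (+-∸-assoc 1 i<L) ⟨
  nth (x ∷ xs) (length xs ∸ i) ∎
  where open ≡-Reasoning
... | inj₂ refl = begin
  nth (reverse (x ∷ xs)) (length xs)            ≡⟨ cong (flip nth (length xs)) (unfold-reverse x xs) ⟩
  nth (reverse xs ∷ʳ x) (length xs)             ≡⟨ cong (nth (reverse xs ∷ʳ x)) (length-reverse xs) ⟨
  nth (reverse xs ∷ʳ x) (length (reverse xs))   ≡⟨ nth-∷ʳ-length (reverse xs) x ⟩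
  nth (x ∷ xs) 0                                ≡⟨ cong (nth (x ∷ xs)) (n∸n≡0 (length xs)) ⟨
  nth (x ∷ xs) (length xs ∸ length xs)          ∎
  where open ≡-Reasoning

mapMaybe-just⁻ : ∀ {A B : Set} {f : A → B} {m y} → mapMaybe f m ≡ just y → ∃ λ x → m ≡ just x × y ≡ f x
mapMaybe-just⁻ {m = just x} refl = x , refl , refl

nth-reverse-map⁻ : ∀ {A B : Set} (f : A → B) xs {r y} → nth (reverse (map f xs)) r ≡ just y →
                   r < length xs × ∃ λ x → nth xs (length xs ∸ suc r) ≡ just x × y ≡ f x
nth-reverse-map⁻ f xs {r} {y} e = r<L , mapMaybe-just⁻ (begin
  mapMaybe f (nth xs (length xs ∸ suc r))
    ≡⟨ nth-map f xs _ ⟨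
  nth (map f xs) (length xs ∸ suc r)
    ≡⟨ cong (λ L → nth (map f xs) (L ∸ suc r)) (length-map f xs) ⟨
  nth (map f xs) (length (map f xs) ∸ suc r)
    ≡⟨ nth-reverse (map f xs) r (subst (r <_) (sym (length-map f xs)) r<L) ⟨
  nth (reverse (map f xs)) r
    ≡⟨ e ⟩
  just y ∎)
  where
  open ≡-Reasoning
  r<L : r < length xs
  r<L = subst (r <_) (trans (length-reverse (map f xs)) (length-map f xs)) (nth-< (reverse (map f xs)) r e)

Unique-++⁻ʳ : ∀ {A : Set} (xs : List A) {ys} → Unique (xs ++ ys) → Unique ys
Unique-++⁻ʳ []       u       = u
Unique-++⁻ʳ (x ∷ xs) (_ ∷ u) = Unique-++⁻ʳ xs u

Unique-++-disjoint : ∀ {A : Set} (xs : List A) {ys x} → Unique (xs ++ ys) → x ∈ xs → x ∈ ys → ⊥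
Unique-++-disjoint (y ∷ xs) (y∉ ∷ _) (here refl) x∈ys = All.lookup y∉ (∈-++⁺ʳ xs x∈ys) refl
Unique-++-disjoint (y ∷ xs) (_ ∷ u)  (there x∈xs) x∈ys = Unique-++-disjoint xs u x∈xs x∈ys

Linked-reverse : ∀ {A : Set} {R : A → A → Set} {xs} → Linked R xs → Linked (flip R) (reverse xs)
Linked-reverse {A} {R} {[]}     []  = []
Linked-reverse {A} {R} {x ∷ xs} Rxs = onto [-] Rxs
  where
  onto : ∀ {x xs acc} → Linked (flip R) (x ∷ acc) → Linked R (x ∷ xs) →
         Linked (flip R) (reverseAcc (x ∷ acc) xs)
  onto acc [-]         = acc
  onto acc (Rxy ∷ Rys) = onto (Rxy ∷ acc) Rys

reverse-map-involutive : ∀ {A : Set} (f : A → A) {xs} → All (λ x → f (f x) ≡ x) xs →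
                         reverse (map f (reverse (map f xs))) ≡ xs
reverse-map-involutive f {xs} ffx≡x = begin
  reverse (map f (reverse (map f xs)))  ≡⟨ cong reverse (reverse-map f (map f xs)) ⟩
  reverse (reverse (map f (map f xs)))  ≡⟨ reverse-involutive (map f (map f xs)) ⟩
  map f (map f xs)                      ≡⟨ map-∘ xs ⟨
  map (f ∘ f) xs                        ≡⟨ map-id-local ffx≡x ⟩
  xs                                    ∎
  where open ≡-Reasoning

concat-reverse : ∀ {A : Set} (xss : List (List A)) →
                 concat (reverse (map reverse xss)) ≡ reverse (concat xss)
concat-reverse []         = refl
concat-reverse (xs ∷ xss) = begin
  concat (reverse (reverse xs ∷ map reverse xss))
    ≡⟨ cong concat (unfold-reverse (reverse xs) (map reverse xss)) ⟩
  concat (reverse (map reverse xss) ∷ʳ reverse xs)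
    ≡⟨ concat-++ (reverse (map reverse xss)) (reverse xs ∷ []) ⟨
  concat (reverse (map reverse xss)) ++ (reverse xs ++ [])
    ≡⟨ cong₂ _++_ (concat-reverse xss) (++-identityʳ (reverse xs)) ⟩
  reverse (concat xss) ++ reverse xs
    ≡⟨ reverse-++ xs (concat xss) ⟨
  reverse (xs ++ concat xss) ∎
  where open ≡-Reasoning

elem⇒∈ : ∀ {x} xs → elem x xs ≡ true → x ∈ xs
elem⇒∈ {x} (y ∷ ys) e with x ≡ᵇ y in x≡ᵇy
... | true  = here (≡ᵇ⇒≡ x y (Equivalence.from T-≡ x≡ᵇy))
... | false = there (elem⇒∈ ys e)

∈⇒elem : ∀ {x xs} → x ∈ xs → elem x xs ≡ true
∈⇒elem {x} (here refl) rewrite Equivalence.to T-≡ (≡⇒≡ᵇ x x refl) = refl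
∈⇒elem {x} (there x∈) rewrite ∈⇒elem x∈ = ∨-zeroʳ _

elem-cong : ∀ {x y xs ys} → (x ∈ xs ⇔ y ∈ ys) → elem x xs ≡ elem y ys
elem-cong x⇔y = ⇔→≡ (mk⇔ (∈⇒elem ∘ to ∘ elem⇒∈ _) (∈⇒elem ∘ from ∘ elem⇒∈ _))
  where open Equivalence x⇔y

-- The map R on fillings

-- Rmap n T unfolds to  reverse (map (complementRow n) T) .
complementRow : ℕ → List ℕ → List ℕ
complementRow n row = reverse (map (complement n) row)

∈-complementRow : ∀ {n x row} → x ≤ suc n → All (_≤ suc n) row →
                  x ∈ complementRow n row ⇔ complement n x ∈ row
∈-complementRow {n} {x} {row} x≤ row≤ = mk⇔ to from
  where
  to : x ∈ complementRow n row → complement n x ∈ row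
  to x∈ with y , y∈ , refl ← ∈-map⁻ (complement n) (Any.reverse⁻ {xs = map (complement n) row} x∈) =
    subst (_∈ row) (sym (complement-involutive (All.lookup row≤ y∈))) y∈
  from : complement n x ∈ row → x ∈ complementRow n row
  from cx∈ = Any.reverse⁺
    (subst (_∈ map (complement n) row) (complement-involutive x≤) (∈-map⁺ (complement n) cx∈))

Linked-complementRow : ∀ {n row} → All (_≤ suc n) row → Linked _<_ row → Linked _<_ (complementRow n row)
Linked-complementRow {n} row≤ increasing = Linked-reverse (Linked.map⁺ (antitone row≤ increasing))
  where
  antitone : ∀ {row} → All (_≤ suc n) row → Linked _<_ row →
             Linked (λ x y → complement n y < complement n x) row
  antitone _                []           = []
  antitone _                [-]          = [-]
  antitone (_ ∷ y≤ ∷ row≤) (x<y ∷ rest) = complement-antitone x<y y≤ ∷ antitone (y≤ ∷ row≤) rest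

Rmap-bounded : ∀ n T → All (All (_≤ suc n)) (Rmap n T)
Rmap-bounded n T = All-resp-↭ (↭-sym (↭-reverse (map (complementRow n) T)))
  (All.map⁺ (All.universal (λ row → All-resp-↭ (↭-sym (↭-reverse (map (complement n) row)))
                                                (All.map⁺ (All.universal (complement-≤ n) row))) T))

Rmap-involutive : ∀ {n T} → All (All (_≤ suc n)) T → Rmap n (Rmap n T) ≡ T
Rmap-involutive {n} T≤ = reverse-map-involutive (complementRow n)
  (All.map (reverse-map-involutive (complement n) ∘ All.map complement-involutive) T≤)

concat-Rmap : ∀ n T → concat (Rmap n T) ≡ reverse (map (complement n) (concat T))
concat-Rmap n T = begin
  concat (reverse (map (reverse ∘ map (complement n)) T))
    ≡⟨ cong (concat ∘ reverse) (map-∘ T) ⟩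
  concat (reverse (map reverse (map (map (complement n)) T)))
    ≡⟨ concat-reverse (map (map (complement n)) T) ⟩
  reverse (concat (map (map (complement n)) T))
    ≡⟨ cong reverse (concat-map T) ⟩
  reverse (map (complement n) (concat T)) ∎
  where open ≡-Reasoning

complement-upTo : ∀ n → map (complement n) (map suc (upTo n)) ≡ reverse (map suc (upTo n))
complement-upTo n = begin
  map (complement n) (map suc (upTo n))   ≡⟨ map-∘ (upTo n) ⟨
  map (n ∸_) (upTo n)                     ≡⟨ countdown n ⟩
  map suc (downFrom n)                    ≡⟨ cong (map suc) (reverse-upTo n) ⟨
  map suc (reverse (upTo n))              ≡⟨ reverse-map suc (upTo n) ⟩
  reverse (map suc (upTo n))              ∎
  where
  open ≡-Reasoning
  countdown : ∀ n → map (n ∸_) (upTo n) ≡ map suc (downFrom n)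
  countdown zero    = refl
  countdown (suc n) = cong (suc n ∷_) (begin
    map (suc n ∸_) (applyUpTo suc n)      ≡⟨ cong (map (suc n ∸_)) (map-upTo suc n) ⟨
    map (suc n ∸_) (map suc (upTo n))     ≡⟨ map-∘ (upTo n) ⟨
    map (n ∸_) (upTo n)                   ≡⟨ countdown n ⟩
    map suc (downFrom n)                  ∎)

↭-Rmap : ∀ {n T} → concat T ↭ map suc (upTo n) → concat (Rmap n T) ↭ map suc (upTo n)
↭-Rmap {n} {T} T↭ = begin
  concat (Rmap n T)                        ≡⟨ concat-Rmap n T ⟩
  reverse (map (complement n) (concat T))  ↭⟨ ↭-reverse (map (complement n) (concat T)) ⟩
  map (complement n) (concat T)            ↭⟨ Perm.map⁺ (complement n) T↭ ⟩
  map (complement n) (map suc (upTo n))    ≡⟨ complement-upTo n ⟩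
  reverse (map suc (upTo n))               ↭⟨ ↭-reverse (map suc (upTo n)) ⟩
  map suc (upTo n)                         ∎
  where open PermutationReasoning

-- Rows of entries, and R ∘ π_i = π_{n−i} ∘ R

rowOf-∷ : ∀ row T x → rowOf (row ∷ T) x ≡ (if elem x row then just 0 else mapMaybe suc (rowOf T x))
rowOf-∷ row T x with elem x row
... | true  = refl
... | false with rowOf T x
...   | just r  = refl
...   | nothing = refl

rowOf-bounded : ∀ T x → Maybe.All (_< length T) (rowOf T x)
rowOf-bounded []        x = nothing
rowOf-bounded (row ∷ T) x rewrite rowOf-∷ row T x with elem x row
... | true = just z<s
... | false with rowOf T x | rowOf-bounded T x
...   | just r  | just r<  = just (s<s r<)
...   | nothing | nothing = nothing

rowOf-∈ : ∀ T x → Maybe.All (λ _ → x ∈ concat T) (rowOf T x)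
rowOf-∈ []        x = nothing
rowOf-∈ (row ∷ T) x rewrite rowOf-∷ row T x with elem x row in e
... | true = just (Any.++⁺ˡ (elem⇒∈ row e))
... | false with rowOf T x | rowOf-∈ T x
...   | just r  | just x∈  = just (Any.++⁺ʳ row x∈)
...   | nothing | nothing = nothing

rowOf-map : ∀ (h : List ℕ → List ℕ) T {x y} → All (λ row → elem x (h row) ≡ elem y row) T →
            rowOf (map h T) x ≡ rowOf T y
rowOf-map h []        []       = refl
rowOf-map h (row ∷ T) {x} {y} (e ∷ es) = begin
  rowOf (h row ∷ map h T) x
    ≡⟨ rowOf-∷ (h row) (map h T) x ⟩
  (if elem x (h row) then just 0 else mapMaybe suc (rowOf (map h T) x))
    ≡⟨ cong₂ (λ b m → if b then just 0 else mapMaybe suc m) e (rowOf-map h T es) ⟩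
  (if elem y row then just 0 else mapMaybe suc (rowOf T y))
    ≡⟨ rowOf-∷ row T y ⟨
  rowOf (row ∷ T) y
    ∎
  where open ≡-Reasoning

rowOf-∷ʳ : ∀ T row x → rowOf (T ∷ʳ row) x ≡ rowOf T x <∣> (if elem x row then just (length T) else nothing)
rowOf-∷ʳ []        row x = rowOf-∷ row [] x
rowOf-∷ʳ (r ∷ T) row x = begin
  rowOf (r ∷ (T ∷ʳ row)) x
    ≡⟨ rowOf-∷ r (T ∷ʳ row) x ⟩
  (if elem x r then just 0 else mapMaybe suc (rowOf (T ∷ʳ row) x))
    ≡⟨ cong (λ m → if elem x r then just 0 else mapMaybe suc m) (rowOf-∷ʳ T row x) ⟩
  (if elem x r then just 0 else mapMaybe suc (rowOf T x <∣> (if elem x row then just (length T) else nothing)))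
    ≡⟨ shift (elem x r) (elem x row) (rowOf T x) ⟩
  (if elem x r then just 0 else mapMaybe suc (rowOf T x)) <∣> (if elem x row then just (suc (length T)) else nothing)
    ≡⟨ cong (_<∣> _) (rowOf-∷ r T x) ⟨
  rowOf (r ∷ T) x <∣> (if elem x row then just (suc (length T)) else nothing)
    ∎
  where
  open ≡-Reasoning
  shift : ∀ a b m → (if a then just 0 else mapMaybe suc (m <∣> (if b then just (length T) else nothing)))
                  ≡ (if a then just 0 else mapMaybe suc m) <∣> (if b then just (suc (length T)) else nothing)
  shift true  b     m         = refl
  shift false b     (just r)  = refl
  shift false true  nothing   = refl
  shift false false nothing   = refl

mirror : ℕ → ℕ → ℕ
mirror k r = k ∸ suc r

rowOf-reverse : ∀ T x → Unique (concat T) → rowOf (reverse T) x ≡ mapMaybe (mirror (length T)) (rowOf T x)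
rowOf-reverse []        x u = refl
rowOf-reverse (row ∷ T) x u = begin
  rowOf (reverse (row ∷ T)) x
    ≡⟨ cong (flip rowOf x) (unfold-reverse row T) ⟩
  rowOf (reverse T ∷ʳ row) x
    ≡⟨ rowOf-∷ʳ (reverse T) row x ⟩
  rowOf (reverse T) x <∣> (if elem x row then just (length (reverse T)) else nothing)
    ≡⟨ cong₂ (λ m L → m <∣> (if elem x row then just L else nothing))
             (rowOf-reverse T x (Unique-++⁻ʳ row u)) (length-reverse T) ⟩
  mapMaybe (mirror L) (rowOf T x) <∣> (if elem x row then just L else nothing)
    ≡⟨ reflect ⟩
  mapMaybe (mirror (suc L)) (if elem x row then just 0 else mapMaybe suc (rowOf T x))
    ≡⟨ cong (mapMaybe (mirror (suc L))) (rowOf-∷ row T x) ⟨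
  mapMaybe (mirror (suc L)) (rowOf (row ∷ T) x)
    ∎
  where
  open ≡-Reasoning
  L = length T
  reflect : mapMaybe (mirror L) (rowOf T x) <∣> (if elem x row then just L else nothing)
          ≡ mapMaybe (mirror (suc L)) (if elem x row then just 0 else mapMaybe suc (rowOf T x))
  reflect with elem x row in e | rowOf T x | rowOf-∈ T x
  ... | true  | just _  | just x∈T = ⊥-elim (Unique-++-disjoint row u (elem⇒∈ row e) x∈T)
  ... | true  | nothing | _        = refl
  ... | false | just _  | _        = refl
  ... | false | nothing | _        = refl

rowOf-Rmap : ∀ {n} T {x} → x ≤ suc n → All (All (_≤ suc n)) T → Unique (concat T) →
             rowOf (Rmap n T) x ≡ mapMaybe (mirror (length T)) (rowOf T (complement n x))
rowOf-Rmap {n} T {x} x≤ T≤ u = begin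
  rowOf (reverse (map (complementRow n) T)) x
    ≡⟨ cong (flip rowOf x) (reverse-map (complementRow n) T) ⟨
  rowOf (map (complementRow n) (reverse T)) x
    ≡⟨ rowOf-map (complementRow n) (reverse T) (All.map (elem-cong ∘ ∈-complementRow x≤) reverseT≤) ⟩
  rowOf (reverse T) (complement n x)
    ≡⟨ rowOf-reverse T (complement n x) u ⟩
  mapMaybe (mirror (length T)) (rowOf T (complement n x)) ∎
  where
  open ≡-Reasoning
  reverseT≤ : All (All (_≤ suc n)) (reverse T)
  reverseT≤ = All-resp-↭ (↭-sym (↭-reverse T)) T≤

swapEnt-Rmap : ∀ {n i} T → suc i ≤ n → All (All (_≤ suc n)) T →
               swapEnt (n ∸ i) (Rmap n T) ≡ Rmap n (swapEnt i T)
swapEnt-Rmap {n} {i} T 1+i≤n T≤ = begin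
  map (map (transpose j)) (reverse (map (complementRow n) T))
    ≡⟨ reverse-map (map (transpose j)) (map (complementRow n) T) ⟩
  reverse (map (map (transpose j)) (map (complementRow n) T))
    ≡⟨ cong reverse (map-∘ T) ⟨
  reverse (map (map (transpose j) ∘ complementRow n) T)
    ≡⟨ cong reverse (map-cong-local (All.map row-conjugate T≤)) ⟩
  reverse (map (complementRow n ∘ map (transpose i)) T)
    ≡⟨ cong reverse (map-∘ T) ⟩
  reverse (map (complementRow n) (map (map (transpose i)) T)) ∎
  where
  open ≡-Reasoning
  j = n ∸ i
  i≤n = ≤-trans (n≤1+n i) 1+i≤n
  complement-i : complement n i ≡ suc j
  complement-i = +-∸-assoc 1 i≤n
  entry-conjugate : ∀ {x} → x ≤ suc n → transpose j (complement n x) ≡ complement n (transpose i x)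
  entry-conjugate = transpose-conjugate (complement n) complement-injective
                      (m≤n⇒m≤1+n i≤n) (m≤n⇒m≤1+n 1+i≤n) complement-i refl
  row-conjugate : ∀ {row} → All (_≤ suc n) row →
                  map (transpose j) (complementRow n row) ≡ complementRow n (map (transpose i) row)
  row-conjugate {row} row≤ = begin
    map (transpose j) (reverse (map (complement n) row))
      ≡⟨ reverse-map (transpose j) (map (complement n) row) ⟩
    reverse (map (transpose j) (map (complement n) row))
      ≡⟨ cong reverse (map-∘ row) ⟨
    reverse (map (transpose j ∘ complement n) row)
      ≡⟨ cong reverse (map-cong-local (All.map entry-conjugate row≤)) ⟩
    reverse (map (complement n ∘ transpose i) row)
      ≡⟨ cong reverse (map-∘ row) ⟩
    reverse (map (complement n) (map (transpose i) row)) ∎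

πRows : Maybe ℕ → Maybe ℕ → ℕ → Filling → Maybe Filling
πRows (just r) (just r′) i T = if r <ᵇ r′ then just T else if r′ <ᵇ r then just (swapEnt i T) else nothing
πRows _        _         i T = nothing

π-unfold : ∀ i T → π i T ≡ πRows (rowOf T i) (rowOf T (suc i)) i T
π-unfold i T with rowOf T i | rowOf T (suc i)
... | just r  | just r′ = refl
... | just r  | nothing = refl
... | nothing | _       = refl

πRows-just : ∀ u v i T {T′} → πRows u v i T ≡ just T′ → T′ ≡ T ⊎ T′ ≡ swapEnt i T
πRows-just (just r) (just r′) i T e with r <ᵇ r′ | r′ <ᵇ r
... | true  | _    = inj₁ (sym (just-injective e))
... | false | true = inj₂ (sym (just-injective e))
πRows-just (just r) (just r′) i T () | false | false
πRows-just (just r) nothing   i T ()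
πRows-just nothing  _         i T ()

<ᵇ-mirror : ∀ {k r r′} → r < k → r′ < k → (mirror k r′ <ᵇ mirror k r) ≡ (r <ᵇ r′)
<ᵇ-mirror {k} {r} {r′} r<k r′<k = ⇔→≡ (mk⇔ (to T-≡ ∘ <⇒<ᵇ ∘ from-mirror ∘ <ᵇ⇒< _ _ ∘ from T-≡)
                                          (to T-≡ ∘ <⇒<ᵇ ∘ to-mirror ∘ <ᵇ⇒< _ _ ∘ from T-≡))
  where
  open Equivalence
  from-mirror : mirror k r′ < mirror k r → r < r′
  from-mirror = s<s⁻¹ ∘ ∸-cancelʳ-< {o = k}
  to-mirror : r < r′ → mirror k r′ < mirror k r
  to-mirror r<r′ = ∸-monoʳ-< (s<s r<r′) r′<k

πRows-mirror : ∀ {k} (f : Filling → Filling) u v {i j T} →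
               Maybe.All (_< k) u → Maybe.All (_< k) v → swapEnt j (f T) ≡ f (swapEnt i T) →
               πRows (mapMaybe (mirror k) v) (mapMaybe (mirror k) u) j (f T) ≡ mapMaybe f (πRows u v i T)
πRows-mirror f (just r) (just r′) (just r<k) (just r′<k) swap-f
  rewrite <ᵇ-mirror r<k r′<k | <ᵇ-mirror r′<k r<k with r <ᵇ r′ | r′ <ᵇ r
... | true  | _     = refl
... | false | true  = cong just swap-f
... | false | false = refl
πRows-mirror f (just r) nothing  _ _ _ = refl
πRows-mirror f nothing  (just _) _ _ _ = refl
πRows-mirror f nothing  nothing  _ _ _ = refl

record Labelled (n : ℕ) (T : Filling) : Set where
  field
    bounded  : All (All (_≤ suc n)) T
    distinct : Unique (concat T)

π-Rmap : ∀ {n i} T → suc i ≤ n → Labelled n T → π (n ∸ i) (Rmap n T) ≡ mapMaybe (Rmap n) (π i T)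
π-Rmap {n} {i} T 1+i≤n L = begin
  π j (Rmap n T)
    ≡⟨ π-unfold j (Rmap n T) ⟩
  πRows (rowOf (Rmap n T) j) (rowOf (Rmap n T) (suc j)) j (Rmap n T)
    ≡⟨ cong₂ (λ u v → πRows u v j (Rmap n T)) (row-of j (m≤n⇒m≤1+n (m∸n≤m n i)) complement-j)
                                              (row-of (suc j) (s≤s (m∸n≤m n i)) complement-1+j) ⟩
  πRows (mapMaybe (mirror k) (rowOf T (suc i))) (mapMaybe (mirror k) (rowOf T i)) j (Rmap n T)
    ≡⟨ πRows-mirror (Rmap n) (rowOf T i) (rowOf T (suc i)) (rowOf-bounded T i) (rowOf-bounded T (suc i))
                    (swapEnt-Rmap T 1+i≤n bounded) ⟩
  mapMaybe (Rmap n) (πRows (rowOf T i) (rowOf T (suc i)) i T)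
    ≡⟨ cong (mapMaybe (Rmap n)) (π-unfold i T) ⟨
  mapMaybe (Rmap n) (π i T)
    ∎
  where
  open ≡-Reasoning
  open Labelled L
  j = n ∸ i
  k = length T
  i≤n = ≤-trans (n≤1+n i) 1+i≤n
  complement-1+j : complement n (suc j) ≡ i
  complement-1+j = m∸[m∸n]≡n i≤n
  complement-j : complement n j ≡ suc i
  complement-j = trans (+-∸-assoc 1 (m∸n≤m n i)) (cong suc complement-1+j)
  row-of : ∀ x {y} → x ≤ suc n → complement n x ≡ y → rowOf (Rmap n T) x ≡ mapMaybe (mirror k) (rowOf T y)
  row-of x x≤ refl = rowOf-Rmap T x≤ bounded distinct

swapEnt-Labelled : ∀ {n i T} → suc i ≤ suc n → Labelled n T → Labelled n (swapEnt i T)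
swapEnt-Labelled {n} {i} {T} 1+i≤ L = record
  { bounded  = All.map⁺ (All.map (All.map⁺ ∘ All.map (transpose-≤ 1+i≤)) bounded)
  ; distinct = subst Unique (sym (concat-map T)) (Unique.map⁺ (transpose-injective i) distinct)
  }
  where open Labelled L

π-Labelled : ∀ {n i T T′} → suc i ≤ suc n → Labelled n T → π i T ≡ just T′ → Labelled n T′
π-Labelled {i = i} {T} 1+i≤ L e
  with πRows-just (rowOf T i) (rowOf T (suc i)) i T (trans (sym (π-unfold i T)) e)
... | inj₁ refl = L
... | inj₂ refl = swapEnt-Labelled 1+i≤ L

Step-Labelled : ∀ {sh n S T} → size sh ≡ n → Labelled n S → Step sh S T → Labelled n T
Step-Labelled refl L (i , _ , 1+i≤ , e) = π-Labelled (m≤n⇒m≤1+n 1+i≤) L e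

Step-Rmap : ∀ {sh sh′ n S T} → size sh ≡ n → size sh′ ≡ n → Labelled n S →
            Step sh S T → Step sh′ (Rmap n S) (Rmap n T)
Step-Rmap {n = n} {S} refl size′ L (i , 1≤i , 1+i≤n , e) =
  n ∸ i , m<n⇒0<n∸m 1+i≤n , subst (suc (n ∸ i) ≤_) (sym size′) (∸-monoʳ-< 1≤i (<⇒≤ 1+i≤n)) ,
  trans (π-Rmap S 1+i≤n L) (cong (mapMaybe (Rmap n)) e)

≼-Rmap : ∀ {sh sh′ n S T} → size sh ≡ n → size sh′ ≡ n → Labelled n S →
         S ≼[ sh ] T → Rmap n S ≼[ sh′ ] Rmap n T
≼-Rmap             size size′ L ε            = ε
≼-Rmap {sh} {sh′} size size′ L (step ◅ S≼T) =
  Step-Rmap {sh} {sh′} size size′ L step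
  ◅ ≼-Rmap {sh} {sh′} size size′ (Step-Labelled {sh} size L step) S≼T

-- Rotating skew shapes

rotateRow : ℕ → ℕ × ℕ → ℕ × ℕ
rotateRow N (a , b) = N ∸ b , N ∸ a

-- The rotation by 180 degrees of a skew shape drawn in the columns 1, …, N.
rotate : ℕ → Shape → Shape
rotate N sh = reverse (map (rotateRow N) sh)

FitsIn : ℕ → Shape → Set
FitsIn N = All (λ row → proj₁ row ≤ N)

RowLengths : Filling → Shape → Set
RowLengths = Pointwise (λ row ab → length row ≡ rowLen ab)

rowLen-rotateRow : ∀ {N} {ab : ℕ × ℕ} → proj₁ ab ≤ N → rowLen (rotateRow N ab) ≡ rowLen ab
rowLen-rotateRow {N} {a , b} a≤N with b ≤? a
... | yes b≤a = begin
  (N ∸ b) ∸ (N ∸ a)                ≡⟨ cong (λ M → (M ∸ b) ∸ (N ∸ a)) (m∸n+n≡m a≤N) ⟨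
  ((N ∸ a + a) ∸ b) ∸ (N ∸ a)      ≡⟨ cong (_∸ (N ∸ a)) (+-∸-assoc (N ∸ a) b≤a) ⟩
  (N ∸ a + (a ∸ b)) ∸ (N ∸ a)      ≡⟨ m+n∸m≡n (N ∸ a) (a ∸ b) ⟩
  a ∸ b                            ∎
  where open ≡-Reasoning
... | no b≰a = trans (m≤n⇒m∸n≡0 (∸-monoʳ-≤ N a≤b)) (sym (m≤n⇒m∸n≡0 a≤b))
  where a≤b = <⇒≤ (≰⇒> b≰a)

size-rotate : ∀ {N sh} → FitsIn N sh → size (rotate N sh) ≡ size sh
size-rotate {N} {sh} fits = begin
  sum (map rowLen (reverse (map (rotateRow N) sh)))
    ≡⟨ cong sum (reverse-map rowLen (map (rotateRow N) sh)) ⟩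
  sum (reverse (map rowLen (map (rotateRow N) sh)))
    ≡⟨ sum-↭ (↭-reverse (map rowLen (map (rotateRow N) sh))) ⟩
  sum (map rowLen (map (rotateRow N) sh))
    ≡⟨ cong sum (map-∘ sh) ⟨
  sum (map (rowLen ∘ rotateRow N) sh)
    ≡⟨ cong sum (map-cong-local (All.map (λ {ab} → rowLen-rotateRow {ab = ab}) fits)) ⟩
  sum (map rowLen sh) ∎
  where open ≡-Reasoning

RowLengths-rotate : ∀ {N n T sh} → FitsIn N sh → RowLengths T sh → RowLengths (Rmap n T) (rotate N sh)
RowLengths-rotate {N} {n} fits lengths = Pointwise.reverse⁺ (rotated fits lengths)
  where
  rotated : ∀ {T sh} → FitsIn N sh → RowLengths T sh →
            RowLengths (map (complementRow n) T) (map (rotateRow N) sh)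
  rotated []           []               = []
  rotated {row ∷ _} {ab ∷ _} (a≤N ∷ fits) (length≡ ∷ lengths) =
    trans (length-reverse (map (complement n) row))
          (trans (length-map (complement n) row) (trans length≡ (sym (rowLen-rotateRow {ab = ab} a≤N))))
    ∷ rotated fits lengths

column-offset : ∀ {a b p} → p < a ∸ b → b < a ∸ p × (a ∸ p) ∸ suc b ≡ (a ∸ b) ∸ suc p
column-offset {a} {b} {p} p<a∸b = b<a∸p , (begin
  (a ∸ p) ∸ suc b     ≡⟨ ∸-+-assoc a p (suc b) ⟩
  a ∸ (p + suc b)     ≡⟨ cong (a ∸_) (trans (+-suc p b) (cong suc (+-comm p b))) ⟩
  a ∸ suc (b + p)     ≡⟨ cong (a ∸_) (+-suc b p) ⟨
  a ∸ (b + suc p)     ≡⟨ ∸-+-assoc a b (suc p) ⟨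
  (a ∸ b) ∸ suc p     ∎)
  where
  open ≡-Reasoning
  b<a : b < a
  b<a = m∸n≢0⇒n<m (λ a∸b≡0 → n≮0 (subst (p <_) a∸b≡0 p<a∸b))
  b<a∸p : b < a ∸ p
  b<a∸p = m+n≤o⇒m≤o∸n (suc b) (subst (_≤ a) (cong suc (+-comm p b)) (m≤o∸n⇒m+n≤o (suc p) (<⇒≤ b<a) p<a∸b))

-- Column c of the rotated row sits over column suc N ∸ c of the row (a , b); positions within a
-- row are counted from its left end.
rotated-column : ∀ {N a b c} → a ≤ N → N ∸ a < c → c ∸ suc (N ∸ a) < a ∸ b →
                 b < suc N ∸ c × (suc N ∸ c) ∸ suc b ≡ (a ∸ b) ∸ suc (c ∸ suc (N ∸ a))
rotated-column {N} {a} {b} {c} a≤N d<c p<a∸b =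
  subst (λ m → b < m × m ∸ suc b ≡ (a ∸ b) ∸ suc p) (sym flipped-column) (column-offset p<a∸b)
  where
  open ≡-Reasoning
  d = N ∸ a
  p = c ∸ suc d
  flipped-column : suc N ∸ c ≡ a ∸ p
  flipped-column = begin
    suc N ∸ c                 ≡⟨ cong₂ (λ M k → suc M ∸ k) (m∸n+n≡m a≤N) (m+[n∸m]≡n d<c) ⟨
    suc (d + a) ∸ suc (d + p) ≡⟨ [m+n]∸[m+o]≡n∸o d a p ⟩
    a ∸ p                     ∎

cellAt : Maybe (ℕ × ℕ) → Maybe (List ℕ) → ℕ → Maybe ℕ
cellAt (just (a , b)) (just row) c = if b <ᵇ c then nth row (c ∸ suc b) else nothing
cellAt _              _          c = nothing

entry-unfold : ∀ sh T r c → entry sh T r c ≡ cellAt (nth sh r) (nth T r) c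
entry-unfold sh T r c with nth sh r | nth T r
... | just (a , b) | just row = refl
... | just _       | nothing  = refl
... | nothing      | _        = refl

data Cell (sh : Shape) (T : Filling) (r c x : ℕ) : Set where
  cell : ∀ {a b row} → nth sh r ≡ just (a , b) → nth T r ≡ just row → b < c →
         nth row (c ∸ suc b) ≡ just x → Cell sh T r c x

entry⇒Cell : ∀ sh T r c {x} → entry sh T r c ≡ just x → Cell sh T r c x
entry⇒Cell sh T r c {x} e = at (nth sh r) (nth T r) refl refl (trans (sym (entry-unfold sh T r c)) e)
  where
  at : ∀ u v → nth sh r ≡ u → nth T r ≡ v → cellAt u v c ≡ just x → Cell sh T r c x
  at (just (a , b)) (just row) sh-r T-r e with b <ᵇ c in b<ᵇc
  ... | true = cell sh-r T-r (<ᵇ⇒< b c (Equivalence.from T-≡ b<ᵇc)) e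
  at (just (a , b)) (just row) _ _ () | false
  at (just _) nothing _ _ ()
  at nothing  _       _ _ ()

Cell⇒entry : ∀ {sh T r c x} → Cell sh T r c x → entry sh T r c ≡ just x
Cell⇒entry {sh} {T} {r} {c} {x} (cell {a} {b} {row} sh-r T-r b<c at) = begin
  entry sh T r c
    ≡⟨ entry-unfold sh T r c ⟩
  cellAt (nth sh r) (nth T r) c
    ≡⟨ cong₂ (λ u v → cellAt u v c) sh-r T-r ⟩
  (if b <ᵇ c then nth row (c ∸ suc b) else nothing)
    ≡⟨ cong (if_then nth row (c ∸ suc b) else nothing) (Equivalence.to T-≡ (<⇒<ᵇ b<c)) ⟩
  nth row (c ∸ suc b)
    ≡⟨ at ⟩
  just x ∎
  where open ≡-Reasoning

Cell-All : ∀ {P : ℕ → Set} {sh T r c x} → All (All P) T → Cell sh T r c x → P x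
Cell-All T≤ (cell _ T-r _ at) = nth-All (nth-All T≤ T-r) at

rotate-Cell : ∀ {N n sh T r c x} → FitsIn N sh → RowLengths T sh → All (All (_≤ suc n)) T →
              Cell (rotate N sh) (Rmap n T) r c x →
              r < length sh × Cell sh T (length sh ∸ suc r) (suc N ∸ c) (complement n x)
rotate-Cell {N} {n} {sh} {T} {r} {c} fits lengths T≤ (cell sh-r T-r d<c at)
  with nth-reverse-map⁻ (rotateRow N) sh sh-r | nth-reverse-map⁻ (complementRow n) T T-r
... | r<k , (a , b) , sh-k , refl | _ , row , T-k , refl
  with nth-reverse-map⁻ (complement n) row at
... | p<len , y , row-y , refl = r<k , cell sh-k T-k′ (proj₁ column) at′
  where
  open ≡-Reasoning
  p = c ∸ suc (N ∸ a)
  T-k′ : nth T (length sh ∸ suc r) ≡ just row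
  T-k′ = subst (λ L → nth T (L ∸ suc r) ≡ just row) (Pointwise.Pointwise-length lengths) T-k
  len : length row ≡ a ∸ b
  len = nth-Pointwise lengths T-k′ sh-k
  column : b < suc N ∸ c × (suc N ∸ c) ∸ suc b ≡ (a ∸ b) ∸ suc p
  column = rotated-column (nth-All fits sh-k) d<c (subst (p <_) len p<len)
  at′ : nth row ((suc N ∸ c) ∸ suc b) ≡ just (complement n (complement n y))
  at′ = begin
    nth row ((suc N ∸ c) ∸ suc b)
      ≡⟨ cong (nth row) (proj₂ column) ⟩
    nth row ((a ∸ b) ∸ suc p)
      ≡⟨ cong (λ L → nth row (L ∸ suc p)) len ⟨
    nth row (length row ∸ suc p)
      ≡⟨ row-y ⟩
    just y
      ≡⟨ cong just (complement-involutive (nth-All (nth-All T≤ T-k′) row-y)) ⟨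
    just (complement n (complement n y)) ∎

IsSET-Labelled : ∀ {sh n T} → size sh ≡ n → IsSET sh T → Labelled n T
IsSET-Labelled {n = n} refl set = record
  { bounded  = All.concat⁻ (All-resp-↭ (↭-sym bijective) (All.map⁺ (All.map m≤n⇒m≤1+n (All.all-upTo n))))
  ; distinct = Unique-resp-↭ (↭⇒↭ₛ (↭-sym bijective)) (Unique.map⁺ suc-injective (Unique.upTo⁺ n))
  }
  where open IsSET set

IsSET⇒Rmap-involutive : ∀ {sh n T} → size sh ≡ n → IsSET sh T → Rmap n (Rmap n T) ≡ T
IsSET⇒Rmap-involutive size≡ = Rmap-involutive ∘ Labelled.bounded ∘ IsSET-Labelled size≡

rotate-SET : ∀ {N n sh T} → FitsIn N sh → size sh ≡ n → IsSET sh T → IsSET (rotate N sh) (Rmap n T)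
rotate-SET {N} {n} {sh} {T} fits size≡ set = record
  { shapeOK   = RowLengths-rotate fits shapeOK
  ; rowsInc   = All-resp-↭ (↭-sym (↭-reverse (map (complementRow n) T)))
                           (All.map⁺ (All.zipWith (uncurry Linked-complementRow) (bounded , rowsInc)))
  ; colsInc   = rotated-colsInc
  ; bijective = subst (λ m → concat (Rmap n T) ↭ map suc (upTo m)) (sym (trans (size-rotate fits) size≡))
                      (↭-Rmap {n} {T} (subst (λ m → concat T ↭ map suc (upTo m)) size≡ bijective))
  }
  where
  open IsSET set
  open Labelled (IsSET-Labelled size≡ set)
  k = length sh
  rotatedCell : ∀ r c {x} → entry (rotate N sh) (Rmap n T) r c ≡ just x → Cell (rotate N sh) (Rmap n T) r c x
  rotatedCell = entry⇒Cell (rotate N sh) (Rmap n T)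
  rotated-colsInc : ∀ r r′ c x y → r < r′ → entry (rotate N sh) (Rmap n T) r c ≡ just x →
                    entry (rotate N sh) (Rmap n T) r′ c ≡ just y → x < y
  rotated-colsInc r r′ c x y r<r′ ex ey
    with rotate-Cell fits shapeOK bounded (rotatedCell r c ex) | rotate-Cell fits shapeOK bounded (rotatedCell r′ c ey)
  ... | _ , x-cell | r′<k , y-cell =
    subst₂ _<_ (complement-involutive x≤) (complement-involutive y≤) (complement-antitone cy<cx (complement-≤ n x))
    where
    x≤ = Cell-All (Rmap-bounded n T) (rotatedCell r c ex)
    y≤ = Cell-All (Rmap-bounded n T) (rotatedCell r′ c ey)
    cy<cx : complement n y < complement n x
    cy<cx = colsInc (k ∸ suc r′) (k ∸ suc r) (suc N ∸ c) _ _ (∸-monoʳ-< (s<s r<r′) r′<k)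
                    (Cell⇒entry y-cell) (Cell⇒entry x-cell)

-- Lobsters

module _ (b c₁ c₂ : ℕ) where
  private
    m = c₂ ⊔ c₁
    N = b + 1 + m
    N≡ : N ≡ suc (m + b)
    N≡ = trans (+-comm (b + 1) m) (trans (cong (m +_) (+-comm b 1)) (+-suc m b))
    N∸[b+1+c] : ∀ c → N ∸ (b + 1 + c) ≡ m ∸ c
    N∸[b+1+c] = [m+n]∸[m+o]≡n∸o (b + 1) m
    N∸[m∸c] : ∀ {c} → c ≤ m → N ∸ (m ∸ c) ≡ b + 1 + c
    N∸[m∸c] {c} c≤m = trans (+-∸-assoc (b + 1) (m∸n≤m m c)) (cong (b + 1 +_) (m∸[m∸n]≡n c≤m))

  rightLobster-fits : FitsIn N (rightLobster b c₁ c₂)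
  rightLobster-fits = +-monoʳ-≤ (b + 1) (m≤m⊔n c₂ c₁) ∷ m≤m+n (b + 1) m ∷ +-monoʳ-≤ (b + 1) (m≤n⊔m c₂ c₁) ∷ []

  leftLobster-fits : FitsIn N (leftLobster b c₂ c₁)
  leftLobster-fits = m≤n+m m (b + 1) ∷ subst (m + b ≤_) (sym N≡) (n≤1+n (m + b)) ∷ m≤n+m m (b + 1) ∷ []

  rotate-rightLobster : rotate N (rightLobster b c₁ c₂) ≡ leftLobster b c₂ c₁
  rotate-rightLobster rewrite m+n∸m≡n (b + 1) m | N∸[b+1+c] c₁ | N∸[b+1+c] c₂ | N≡ = refl

  rotate-leftLobster : rotate N (leftLobster b c₂ c₁) ≡ rightLobster b c₁ c₂
  rotate-leftLobster rewrite N∸[m∸c] (m≤m⊔n c₂ c₁) | N∸[m∸c] (m≤n⊔m c₂ c₁) | m+n∸n≡m (b + 1) m | N≡ =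
    cong (λ k → (b + 1 + c₂ , b + 1) ∷ (b + 1 , k) ∷ (b + 1 + c₁ , b + 1) ∷ []) (m+n∸n≡m 1 (m + b))

  size-rightLobster : size (rightLobster b c₁ c₂) ≡ b + c₁ + c₂
  size-rightLobster rewrite m+n∸m≡n (b + 1) c₂ | m+n∸n≡m b 1 | m+n∸m≡n (b + 1) c₁ | +-identityʳ c₁ =
    +-comm c₂ (b + c₁)

  size-leftLobster : size (leftLobster b c₂ c₁) ≡ b + c₁ + c₂
  size-leftLobster =
    trans (cong size (sym rotate-rightLobster)) (trans (size-rotate rightLobster-fits) size-rightLobster)

  Rmap-rightLobster : ∀ {T} → IsSET (rightLobster b c₁ c₂) T →
                      IsSET (leftLobster b c₂ c₁) (Rmap (b + c₁ + c₂) T)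
  Rmap-rightLobster {T} = subst (λ sh → IsSET sh (Rmap (b + c₁ + c₂) T)) rotate-rightLobster
                        ∘ rotate-SET rightLobster-fits size-rightLobster

  Rmap-leftLobster : ∀ {U} → IsSET (leftLobster b c₂ c₁) U →
                     IsSET (rightLobster b c₁ c₂) (Rmap (b + c₁ + c₂) U)
  Rmap-leftLobster {U} = subst (λ sh → IsSET sh (Rmap (b + c₁ + c₂) U)) rotate-leftLobster
                       ∘ rotate-SET leftLobster-fits size-leftLobster

lemma19 : ∀ (b c₁ c₂ : ℕ) → 1 ≤ b → 1 ≤ c₁ → 1 ≤ c₂ →
    let n = b + c₁ + c₂
        Rsh = rightLobster b c₁ c₂
        Lsh = leftLobster b c₂ c₁
    in ((T : Filling) → IsSET Rsh T → IsSET Lsh (Rmap n T))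
       × ((S T : Filling) → IsSET Rsh S → IsSET Rsh T → Rmap n S ≡ Rmap n T → S ≡ T)
       × ((U : Filling) → IsSET Lsh U → Σ Filling λ T → IsSET Rsh T × (Rmap n T ≡ U))
       × ((S T : Filling) → IsSET Rsh S → IsSET Rsh T →
            (S ≼[ Rsh ] T) ⇔ (Rmap n S ≼[ Lsh ] Rmap n T))
lemma19 b c₁ c₂ _ _ _ = (λ _ → Rmap-rightLobster b c₁ c₂) , injective , surjective , order-preserving
  where
  n = b + c₁ + c₂
  Rsh = rightLobster b c₁ c₂
  Lsh = leftLobster b c₂ c₁
  involutive : ∀ {T} → IsSET Rsh T → Rmap n (Rmap n T) ≡ T
  involutive = IsSET⇒Rmap-involutive (size-rightLobster b c₁ c₂)
  injective : (S T : Filling) → IsSET Rsh S → IsSET Rsh T → Rmap n S ≡ Rmap n T → S ≡ T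
  injective S T S∈ T∈ RS≡RT = trans (sym (involutive S∈)) (trans (cong (Rmap n) RS≡RT) (involutive T∈))
  surjective : (U : Filling) → IsSET Lsh U → Σ Filling λ T → IsSET Rsh T × (Rmap n T ≡ U)
  surjective U U∈ =
    Rmap n U , Rmap-leftLobster b c₁ c₂ U∈ , IsSET⇒Rmap-involutive (size-leftLobster b c₁ c₂) U∈
  order-preserving : (S T : Filling) → IsSET Rsh S → IsSET Rsh T →
                     (S ≼[ Rsh ] T) ⇔ (Rmap n S ≼[ Lsh ] Rmap n T)
  order-preserving S T S∈ T∈ = mk⇔
    (≼-Rmap {Rsh} {Lsh} size-R size-L (IsSET-Labelled size-R S∈))
    (subst₂ (_≼[ Rsh ]_) (involutive S∈) (involutive T∈)
      ∘ ≼-Rmap {Lsh} {Rsh} size-L size-R (IsSET-Labelled size-L (Rmap-rightLobster b c₁ c₂ S∈)))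
    where
    size-R = size-rightLobster b c₁ c₂
    size-L = size-leftLobster b c₁ c₂
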